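{- Let $n\geq 3$ and let $G$ be an edge-colored $K^{(3)}_{n,n,n}$ with partite sets $V_1,V_2,V_3$, containing no rainbow copy of $\mathcal{M}$, with $k=|C(G)|\geq 3$. Then, numbering the colors $1,\ldots,k$, some partite set $V_\ell$ can be partitioned into $k$ parts $V_{\ell,1},\ldots,V_{\ell,k}$ such that for each $i\in[k]$, all edges containing a vertex of $V_{\ell,i}$ have color $i$.
   Context: $K^{(3)}_{n,n,n}$ with partite sets $V_1,V_2,V_3$ (disjoint, each of size $n$) is the 3-graph whose edges are all $\{x,y,z\}$ with $x\in V_1,y\in V_2,z\in V_3$. An edge-coloring is any map from edges to colors; $C(G)$ is the set of colors used; a copy is rainbow if its edges have pairwise distinct colors. The messy path $\mathcal{M}$ is the 3-graph with edges $\{v_1v_2v_3,v_2v_3v_4,v_4v_5v_6\}$. -}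

module Defs where

open import Data.Nat using (ℕ)
open import Data.Fin using (Fin; zero; suc)
open import Data.Product using (_×_; _,_; ∃-syntax)
open import Data.List using (List; _∷_; [])
open import Data.List.Relation.Binary.Permutation.Propositional using (_↭_)
open import Relation.Binary.PropositionalEquality using (_≡_; _≢_)
open import Function.Definitions using (Injective; Surjective)

-- An edge-colouring of K^(3)_{n,n,n} with colour set Fin k:
-- V₁ = V₂ = V₃ = Fin n (tagged by the part index), the edge {x,y,z} with
-- x ∈ V₁, y ∈ V₂, z ∈ V₃ gets colour  c x y z.
Coloring : ℕ → ℕ → Set
Coloring n k = Fin n → Fin n → Fin n → Fin k

Vertex : ℕ → Set
Vertex n = Fin 3 × Fin n

EdgeWithColor : ∀ {n k} → Coloring n k → Vertex n → Vertex n → Vertex n → Fin k → Set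
EdgeWithColor {n} c u v w col =
  ∃[ x ] ∃[ y ] ∃[ z ]
    ((u ∷ v ∷ w ∷ []) ↭ ((zero , x) ∷ (suc zero , y) ∷ (suc (suc zero) , z) ∷ []))
    × (c x y z ≡ col)

RainbowMessyPath : ∀ {n k} → Coloring n k → Set
RainbowMessyPath {n} {k} c =
  ∃[ v ] Injective _≡_ _≡_ v ×
  ∃[ a ] ∃[ b ] ∃[ d ]
    EdgeWithColor c (v v₁) (v v₂) (v v₃) a ×
    EdgeWithColor c (v v₂) (v v₃) (v v₄) b ×
    EdgeWithColor c (v v₄) (v v₅) (v v₆) d ×
    (a ≢ b) × (a ≢ d) × (b ≢ d)
  where
  v₁ v₂ v₃ v₄ v₅ v₆ : Fin 6
  v₁ = zero
  v₂ = suc zero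
  v₃ = suc (suc zero)
  v₄ = suc (suc (suc zero))
  v₅ = suc (suc (suc (suc zero)))
  v₆ = suc (suc (suc (suc (suc zero))))

coord : ∀ {n} → Fin 3 → Fin n → Fin n → Fin n → Fin n
coord zero x y z = x
coord (suc zero) x y z = y
coord (suc (suc zero)) x y z = z

-- C(G) = Fin k, i.e. every colour 0..k-1 is used (so |C(G)| = k).
UsesAllColors : ∀ {n k} → Coloring n k → Set
UsesAllColors {n} {k} c = ∀ (col : Fin k) → ∃[ x ] ∃[ y ] ∃[ z ] c x y z ≡ col

{-# OPTIONS --safe #-}
-- Without a rainbow messy path, distinct colors at x and x′ on the line through (y, z)
-- force every edge (x′, y′, z′) with y′ ≠ y, z′ ≠ z to repeat one of them, and likewise
-- in the other two directions.  If some line is rainbow, this pins every point off its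
-- cross (y′ ≠ y and z′ ≠ z) to its color on the line; passing through a parallel line
-- off the cross shows that the color depends on that one coordinate, which is the
-- partition.  If no line is rainbow, every two-colored line confines the edges off its
-- cross to its two colors.  A third color then yields an L-shaped corner with three
-- colors, and the lines through it confine a generic point (n ≥ 3) to no color at all.
module Submission where

open import Defs
open import Data.Nat using (ℕ; _≥_; _≤_; s≤s)
open import Data.Fin using (Fin; zero; suc; remQuot)
open import Data.Fin.Properties using (_≟_; any?; *↔×)
open import Data.Product using (_×_; _,_; proj₁; proj₂; ∃-syntax; Σ-syntax)
open import Data.Sum using (_⊎_; inj₁; inj₂; [_,_]; swap)
open import Data.Empty using (⊥-elim)
open import Data.List using (_∷_; [])
open import Data.List.Relation.Binary.Permutation.Propositional using (↭-refl; ↭-trans)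
open import Data.List.Relation.Binary.Permutation.Propositional.Properties using (shift)
open import Function using (_∘_; Injection)
open import Function.Definitions using (Injective)
open import Function.Properties.Inverse using (↔⇒↣)
open import Relation.Binary.PropositionalEquality
  using (_≡_; _≢_; refl; sym; trans; cong; subst; ≢-sym)
open import Relation.Nullary using (¬_; Dec; yes; no)
open import Relation.Nullary.Decidable using (_×-dec_; ¬?)

private variable
  A : Set
  m n k : ℕ

_∈[_,_] : A → A → A → Set
a ∈[ b , d ] = a ≡ b ⊎ a ≡ d

∈-≢⇒≡ : {a b d : A} → a ∈[ b , d ] → a ≢ b → a ≡ d
∈-≢⇒≡ (inj₁ a≡b) a≢b = ⊥-elim (a≢b a≡b)
∈-≢⇒≡ (inj₂ a≡d) _   = a≡d

∈-both⇒≡ : {x a b d : A} → a ≢ b → x ∈[ d , a ] → x ∈[ d , b ] → x ≡ d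
∈-both⇒≡ _   (inj₁ x≡d) _          = x≡d
∈-both⇒≡ _   (inj₂ _)   (inj₁ x≡d) = x≡d
∈-both⇒≡ a≢b (inj₂ x≡a) (inj₂ x≡b) = ⊥-elim (a≢b (trans (sym x≡a) x≡b))

Distinct₃ : A → A → A → Set
Distinct₃ a b d = a ≢ b × a ≢ d × b ≢ d

Distinct₃-resp : {a b d a′ b′ d′ : A} →
  a ≡ a′ → b ≡ b′ → d ≡ d′ → Distinct₃ a b d → Distinct₃ a′ b′ d′
Distinct₃-resp refl refl refl distinct = distinct

fresh : 3 ≤ n → (a b : Fin n) → ∃[ d ] d ≢ a × d ≢ b
fresh (s≤s (s≤s (s≤s _))) zero          zero          = suc zero , (λ ()) , (λ ())
fresh (s≤s (s≤s (s≤s _))) zero          (suc zero)    = suc (suc zero) , (λ ()) , (λ ())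
fresh (s≤s (s≤s (s≤s _))) zero          (suc (suc _)) = suc zero , (λ ()) , (λ ())
fresh (s≤s (s≤s (s≤s _))) (suc zero)    zero          = suc (suc zero) , (λ ()) , (λ ())
fresh (s≤s (s≤s (s≤s _))) (suc (suc _)) zero          = suc zero , (λ ()) , (λ ())
fresh (s≤s (s≤s (s≤s _))) (suc _)       (suc _)       = zero , (λ ()) , (λ ())

Rainbow : (A → Fin k) → Set
Rainbow f = ∃[ i ] ∃[ j ] ∃[ l ] Distinct₃ (f i) (f j) (f l)

rainbow? : (f : Fin m → Fin k) → Dec (Rainbow f)
rainbow? f = any? λ i → any? λ j → any? λ l →
  ¬? (f i ≟ f j) ×-dec ¬? (f i ≟ f l) ×-dec ¬? (f j ≟ f l)

Rainbow-resp : {f g : A → Fin k} → (∀ x → f x ≡ g x) → Rainbow f → Rainbow g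
Rainbow-resp f≗g (i , j , l , distinct) =
  i , j , l , Distinct₃-resp (f≗g i) (f≗g j) (f≗g l) distinct

rainbow-avoid : {f : A → Fin k} → Rainbow f → ∀ x → ∃[ i ] ∃[ j ] Distinct₃ (f i) (f j) (f x)
rainbow-avoid {f = f} (i , j , l , fi≢fj , fi≢fl , fj≢fl) x with f x ≟ f i | f x ≟ f j
... | yes fx≡fi | _ =
  j , l , Distinct₃-resp refl refl (sym fx≡fi) (fj≢fl , ≢-sym fi≢fj , ≢-sym fi≢fl)
... | no _ | yes fx≡fj =
  i , l , Distinct₃-resp refl refl (sym fx≡fj) (fi≢fl , fi≢fj , ≢-sym fj≢fl)
... | no fx≢fi | no fx≢fj = i , j , fi≢fj , ≢-sym fx≢fi , ≢-sym fx≢fj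

nonRainbow-partner : {f : A → Fin k} {i j : A} {d : Fin k} → ¬ Rainbow f →
  Distinct₃ (f i) (f j) d → ∀ x → ∃[ x′ ] Distinct₃ (f x) (f x′) d
nonRainbow-partner {f = f} {i} {j} {d} noRainbow distinct@(_ , fi≢d , _) x
  with f x ≟ d | f x ≟ f i
... | yes fx≡d | _ =
  ⊥-elim (noRainbow (i , j , x , Distinct₃-resp refl refl (sym fx≡d) distinct))
... | no _ | yes fx≡fi = j , Distinct₃-resp (sym fx≡fi) refl refl distinct
... | no fx≢d | no fx≢fi = i , fx≢fi , fx≢d , fi≢d

-- The coordinate from part ℓ comes first, the others follow cyclically; being cyclic,
-- a view of a view is again a view.
along : Fin 3 → Coloring n k → Coloring n k
along zero             c       = c
along (suc zero)       c y z x = c x y z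
along (suc (suc zero)) c z x y = c x y z

next : Fin 3 → Fin 3
next zero             = suc zero
next (suc zero)       = suc (suc zero)
next (suc (suc zero)) = zero

next³ : ∀ j → next (next (next j)) ≡ j
next³ zero             = refl
next³ (suc zero)       = refl
next³ (suc (suc zero)) = refl

next-injective : Injective _≡_ _≡_ next
next-injective {i} {j} eq = trans (sym (next³ i)) (trans (cong (next ∘ next) eq) (next³ j))

-- The part holding the j-th argument of along ℓ c.
partOf : Fin 3 → Fin 3 → Fin 3
partOf zero             j = j
partOf (suc zero)       j = next j
partOf (suc (suc zero)) j = next (next j)

partOf-injective : ∀ ℓ → Injective _≡_ _≡_ (partOf ℓ)
partOf-injective zero             eq = eq
partOf-injective (suc zero)       eq = next-injective eq
partOf-injective (suc (suc zero)) eq = next-injective (next-injective eq)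

edge : (c : Coloring n k) → ∀ x y z →
  EdgeWithColor c (zero , x) (suc zero , y) (suc (suc zero) , z) (c x y z)
edge c x y z = x , y , z , ↭-refl , refl

edge-rotate : {c : Coloring n k} {u v w : Vertex n} {col : Fin k} →
  EdgeWithColor c u v w col → EdgeWithColor c v w u col
edge-rotate (x , y , z , perm , color) =
  x , y , z , ↭-trans (shift _ (_ ∷ _ ∷ []) []) perm , color

along-edge : (c : Coloring n k) → ∀ ℓ a b d →
  EdgeWithColor c (partOf ℓ zero , a) (partOf ℓ (suc zero) , b) (partOf ℓ (suc (suc zero)) , d)
    (along ℓ c a b d)
along-edge c zero             a b d = edge c a b d
along-edge c (suc zero)       a b d = edge-rotate (edge c d a b)
along-edge c (suc (suc zero)) a b d = edge-rotate (edge-rotate (edge c b d a))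

module _ (part : Fin 3 → Fin 3) (label : Fin 2 → Fin 3 → Fin n) where

  place : Fin 2 × Fin 3 → Vertex n
  place (b , j) = part j , label b j

  place-injective : Injective _≡_ _≡_ part → (∀ j → label zero j ≢ label (suc zero) j) →
    Injective _≡_ _≡_ place
  place-injective part-injective apart {b , j} {b′ , j′} eq
    with part-injective (cong proj₁ eq)
  ... | refl = cong (_, j) (row-injective b b′ (cong proj₂ eq))
    where
    row-injective : ∀ b b′ → label b j ≡ label b′ j → b ≡ b′
    row-injective zero       zero       _  = refl
    row-injective zero       (suc zero) eq = ⊥-elim (apart j eq)
    row-injective (suc zero) zero       eq = ⊥-elim (apart j (sym eq))
    row-injective (suc zero) (suc zero) _  = refl

-- The messy path x, y, z, x′, y′, z′ (edges xyz, yzx′, x′y′z′) is not rainbow.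
MessyFree : Coloring n k → Set
MessyFree c = ∀ {x x′ y z y′ z′} → c x y z ≢ c x′ y z → y′ ≢ y → z′ ≢ z →
  c x′ y′ z′ ∈[ c x′ y z , c x y z ]

messyFree : (c : Coloring n k) → ¬ RainbowMessyPath c → ∀ ℓ → MessyFree (along ℓ c)
messyFree {n} c noPath ℓ {x} {x′} {y} {z} {y′} {z′} a≢b y′≢y z′≢z
  with along ℓ c x′ y′ z′ ≟ along ℓ c x′ y z | along ℓ c x′ y′ z′ ≟ along ℓ c x y z
... | yes d≡b | _       = inj₁ d≡b
... | no _    | yes d≡a = inj₂ d≡a
... | no d≢b  | no d≢a  = ⊥-elim (noPath
      ( vertex , vertex-injective , _ , _ , _
      , along-edge c ℓ x y z , edge-rotate (along-edge c ℓ x′ y z) , along-edge c ℓ x′ y′ z′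
      , a≢b , ≢-sym d≢a , ≢-sym d≢b ))
  where
  label : Fin 2 → Fin 3 → Fin n
  label zero       j = coord j x y z
  label (suc zero) j = coord j x′ y′ z′

  apart : ∀ j → label zero j ≢ label (suc zero) j
  apart zero             refl = a≢b refl
  apart (suc zero)       = ≢-sym y′≢y
  apart (suc (suc zero)) = ≢-sym z′≢z

  -- Writing i = 3b + j, vertex i is the j-th coordinate of triple b.
  vertex : Fin 6 → Vertex n
  vertex = place (partOf ℓ) label ∘ remQuot {2} 3

  vertex-injective : Injective _≡_ _≡_ vertex
  vertex-injective eq = Injection.injective (↔⇒↣ (*↔× {2} {3}))
    (place-injective (partOf ℓ) label (partOf-injective ℓ) apart eq)

RainbowLine : Coloring n k → Set
RainbowLine c = ∃[ y ] ∃[ z ] Rainbow (λ x → c x y z)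

rainbowLine? : (c : Coloring n k) → Dec (RainbowLine c)
rainbowLine? c = any? λ y → any? λ z → rainbow? (λ x → c x y z)

offCross-pinned : {c : Coloring n k} {x₁ x₂ x y₀ z₀ y z : Fin n} → MessyFree c →
  Distinct₃ (c x₁ y₀ z₀) (c x₂ y₀ z₀) (c x y₀ z₀) → y ≢ y₀ → z ≢ z₀ → c x y z ≡ c x y₀ z₀
offCross-pinned free (a≢b , a≢e , b≢e) y≢y₀ z≢z₀ =
  ∈-both⇒≡ a≢b (free a≢e y≢y₀ z≢z₀) (free b≢e y≢y₀ z≢z₀)

rainbow⇒pinned : {c : Coloring n k} {y₀ z₀ : Fin n} → MessyFree c → Rainbow (λ x → c x y₀ z₀) →
  ∀ x {y z} → y ≢ y₀ → z ≢ z₀ → c x y z ≡ c x y₀ z₀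
rainbow⇒pinned {c = c} free rainbow x with rainbow-avoid rainbow x
... | _ , _ , distinct = offCross-pinned {c = c} free distinct

-- A line off the cross of a rainbow line repeats it, so is rainbow too; every point is
-- off the cross of such a line.
rainbow⇒constant : {c : Coloring n k} {y₀ z₀ : Fin n} → 3 ≤ n → MessyFree c →
  Rainbow (λ x → c x y₀ z₀) → ∀ x y z → c x y z ≡ c x y₀ z₀
rainbow⇒constant {c = c} {y₀} {z₀} n≥3 free rainbow x y z
  with fresh n≥3 y₀ y | fresh n≥3 z₀ z
... | y′ , y′≢y₀ , y′≢y | z′ , z′≢z₀ , z′≢z =
  trans (rainbow⇒pinned free rainbow′ x (≢-sym y′≢y) (≢-sym z′≢z)) (pinned x)
  where
  pinned : ∀ x → c x y′ z′ ≡ c x y₀ z₀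
  pinned x = rainbow⇒pinned free rainbow x y′≢y₀ z′≢z₀

  rainbow′ : Rainbow (λ x → c x y′ z′)
  rainbow′ = Rainbow-resp (λ x → sym (pinned x)) rainbow

along-first⇒coord : ∀ ℓ (c : Coloring n k) {p : Fin n → Fin k} →
  (∀ a b d → along ℓ c a b d ≡ p a) → ∀ x y z → c x y z ≡ p (coord ℓ x y z)
along-first⇒coord zero             c first = first
along-first⇒coord (suc zero)       c first x y z = first y z x
along-first⇒coord (suc (suc zero)) c first x y z = first z x y

coord-surjective : ∀ ℓ {c : Coloring n k} {p : Fin n → Fin k} →
  (∀ x y z → c x y z ≡ p (coord ℓ x y z)) → UsesAllColors c → ∀ i → ∃[ v ] p v ≡ i
coord-surjective ℓ factor usesAll i =
  let (x , y , z , color≡i) = usesAll i in coord ℓ x y z , trans (sym (factor x y z)) color≡i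

Confined : Coloring n k → Set
Confined c = ∀ {x₁ x₂ y₀ z₀} → c x₁ y₀ z₀ ≢ c x₂ y₀ z₀ →
  ∀ {x y z} → y ≢ y₀ → z ≢ z₀ → c x y z ∈[ c x₁ y₀ z₀ , c x₂ y₀ z₀ ]

confined : {c : Coloring n k} → MessyFree c → ¬ RainbowLine c → Confined c
confined {c = c} free noRainbow {x₁} {x₂} {y₀} {z₀} a≢b {x} {y} {z} y≢y₀ z≢z₀
  with c x y₀ z₀ ≟ c x₁ y₀ z₀ | c x y₀ z₀ ≟ c x₂ y₀ z₀
... | yes e≡a | _ =
  subst (λ e → c x y z ∈[ e , c x₂ y₀ z₀ ]) e≡a
    (free (λ b≡e → a≢b (trans (sym e≡a) (sym b≡e))) y≢y₀ z≢z₀)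
... | no _ | yes e≡b =
  swap (subst (λ e → c x y z ∈[ e , c x₁ y₀ z₀ ]) e≡b
    (free (λ a≡e → a≢b (trans a≡e e≡b)) y≢y₀ z≢z₀))
... | no e≢a | no e≢b =
  ⊥-elim (noRainbow (y₀ , z₀ , x₁ , x₂ , x , a≢b , ≢-sym e≢a , ≢-sym e≢b))

AllConfined : Coloring n k → Set
AllConfined c = ∀ ℓ → Confined (along ℓ c)

AllConfined-along : {c : Coloring n k} → AllConfined c → ∀ ℓ → AllConfined (along ℓ c)
AllConfined-along conf zero                              = conf
AllConfined-along conf (suc zero)       zero             = conf (suc zero)
AllConfined-along conf (suc zero)       (suc zero)       = conf (suc (suc zero))
AllConfined-along conf (suc zero)       (suc (suc zero)) = conf zero
AllConfined-along conf (suc (suc zero)) zero             = conf (suc (suc zero))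
AllConfined-along conf (suc (suc zero)) (suc zero)       = conf zero
AllConfined-along conf (suc (suc zero)) (suc (suc zero)) = conf (suc zero)

-- Let e, g, d be the colors at the corner and at the ends of its y- and z-legs, and f
-- the color of (x*, y′, z).  The generic point q = (x*, y*, z*) is off the crosses of
-- both legs, so it has color e; it is also off the cross of the two-colored x-line
-- {g, f} through (y′, z), so e = f.  That line also catches (x, y, z′), so d = f = e.
corner-free : {c : Coloring n k} → 3 ≤ n → AllConfined c →
  ∀ {x y z y′ z′} → ¬ Distinct₃ (c x y z) (c x y′ z) (c x y z′)
corner-free {c = c} n≥3 conf {x} {y} {z} {y′} {z′} (e≢g , e≢d , g≢d)
  with fresh n≥3 x x | fresh n≥3 y y′ | fresh n≥3 z z
... | x* , x*≢x , _ | y* , y*≢y , y*≢y′ | z* , z*≢z , _ = e≢d (trans e≡f (sym d≡f))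
  where
  y′≢y : y′ ≢ y
  y′≢y refl = e≢g refl

  z′≢z : z′ ≢ z
  z′≢z refl = e≢d refl

  f∈ : c x* y′ z ∈[ c x y z , c x y z′ ]
  f∈ = conf (suc (suc zero)) e≢d x*≢x y′≢y

  g≢f : c x y′ z ≢ c x* y′ z
  g≢f g≡f = [ (λ f≡e → e≢g (sym (trans g≡f f≡e))) , (λ f≡d → g≢d (trans g≡f f≡d)) ] f∈

  q≡e : c x* y* z* ≡ c x y z
  q≡e = ∈-both⇒≡ g≢d (conf (suc zero) e≢g z*≢z x*≢x) (conf (suc (suc zero)) e≢d x*≢x y*≢y)

  e≡f : c x y z ≡ c x* y′ z
  e≡f = ∈-≢⇒≡ (subst (_∈[ c x y′ z , c x* y′ z ]) q≡e (conf zero g≢f y*≢y′ z*≢z)) e≢g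

  d≡f : c x y z′ ≡ c x* y′ z
  d≡f = ∈-≢⇒≡ (conf zero g≢f (≢-sym y′≢y) z′≢z) (≢-sym g≢d)

twoColoredLine-noThird : {c : Coloring n k} → 3 ≤ n → AllConfined c → ¬ RainbowLine c →
  ∀ {x₁ x₂ y₀ z₀ x y z} → ¬ Distinct₃ (c x₁ y₀ z₀) (c x₂ y₀ z₀) (c x y z)
twoColoredLine-noThird {c = c} n≥3 conf noRainbow {x₁} {x₂} {y₀} {z₀} {x} {y} {z}
  distinct@(a≢b , a≢d , b≢d) with y ≟ y₀ | z ≟ z₀
... | yes refl | yes refl = noRainbow (y₀ , z₀ , x₁ , x₂ , x , distinct)
... | no y≢y₀  | no z≢z₀  = [ a≢d ∘ sym , b≢d ∘ sym ] (conf zero a≢b y≢y₀ z≢z₀)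
... | yes refl | no _ =
  let (x′ , e≢g , e≢d , g≢d) = nonRainbow-partner (λ r → noRainbow (y₀ , z₀ , r)) distinct x
  in corner-free n≥3 (AllConfined-along conf (suc zero)) {y₀} {z₀} {x} {z} {x′}
       (e≢d , e≢g , ≢-sym g≢d)
... | no _ | yes refl =
  let (x′ , partner) = nonRainbow-partner (λ r → noRainbow (y₀ , z₀ , r)) distinct x
  in corner-free n≥3 (AllConfined-along conf (suc (suc zero))) {z₀} {x} {y₀} {x′} {y} partner

TwoColoredLine : Coloring n k → Set
TwoColoredLine c = ∃[ x₁ ] ∃[ x₂ ] ∃[ y ] ∃[ z ] c x₁ y z ≢ c x₂ y z

nonconstant⇒twoColoredLine : (c : Coloring n k) {x₁ y₁ z₁ x₂ y₂ z₂ : Fin n} →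
  c x₁ y₁ z₁ ≢ c x₂ y₂ z₂ → ∃[ ℓ ] TwoColoredLine (along ℓ c)
nonconstant⇒twoColoredLine c {x₁} {y₁} {z₁} {x₂} {y₂} {z₂} a≢b
  with c x₁ y₁ z₁ ≟ c x₂ y₁ z₁ | c x₂ y₁ z₁ ≟ c x₂ y₂ z₁
... | no  step₁ | _         = zero , x₁ , x₂ , y₁ , z₁ , step₁
... | yes _     | no  step₂ = suc zero , y₁ , y₂ , z₁ , x₂ , step₂
... | yes eq₁   | yes eq₂   =
  suc (suc zero) , z₁ , z₂ , x₂ , y₂ , λ eq₃ → a≢b (trans eq₁ (trans eq₂ eq₃))

AtLeastThreeColors : Coloring n k → Set
AtLeastThreeColors c = ∀ α β → ∃[ x ] ∃[ y ] ∃[ z ] c x y z ≢ α × c x y z ≢ β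

AtLeastThreeColors-along : {c : Coloring n k} → AtLeastThreeColors c →
  ∀ ℓ → AtLeastThreeColors (along ℓ c)
AtLeastThreeColors-along three zero = three
AtLeastThreeColors-along three (suc zero) α β =
  let (x , y , z , avoids) = three α β in y , z , x , avoids
AtLeastThreeColors-along three (suc (suc zero)) α β =
  let (x , y , z , avoids) = three α β in z , x , y , avoids

usesAll⇒atLeastThree : {c : Coloring n k} → 3 ≤ k → UsesAllColors c → AtLeastThreeColors c
usesAll⇒atLeastThree k≥3 usesAll α β =
  let (γ , γ≢α , γ≢β) = fresh k≥3 α β
      (x , y , z , color≡γ) = usesAll γ
  in x , y , z , subst (_≢ α) (sym color≡γ) γ≢α , subst (_≢ β) (sym color≡γ) γ≢β

atMostTwoColors : {c : Coloring n k} → 3 ≤ n → AllConfined c →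
  (∀ ℓ → ¬ RainbowLine (along ℓ c)) → ¬ AtLeastThreeColors c
atMostTwoColors {c = c} n≥3@(s≤s _) conf noRainbow three
  with three (c zero zero zero) (c zero zero zero)
... | _ , _ , _ , other≢origin , _
  with nonconstant⇒twoColoredLine c (≢-sym other≢origin)
... | ℓ , x₁ , x₂ , y₀ , z₀ , a≢b
  with AtLeastThreeColors-along three ℓ (along ℓ c x₁ y₀ z₀) (along ℓ c x₂ y₀ z₀)
... | _ , _ , _ , d≢a , d≢b =
  twoColoredLine-noThird n≥3 (AllConfined-along conf ℓ) (noRainbow ℓ) (a≢b , ≢-sym d≢a , ≢-sym d≢b)

theorem1p14 : (n k : ℕ) → n ≥ 3 → k ≥ 3 → (c : Coloring n k) →
    UsesAllColors c → ¬ RainbowMessyPath c →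
    Σ[ ℓ ∈ Fin 3 ] Σ[ p ∈ (Fin n → Fin k) ] (∀ (i : Fin k) → ∃[ v ] p v ≡ i) ×
    (∀ x y z → c x y z ≡ p (coord ℓ x y z))
theorem1p14 n k n≥3 k≥3 c usesAll noPath with any? (λ ℓ → rainbowLine? (along ℓ c))
... | yes (ℓ , y₀ , z₀ , rainbow) = ℓ , color , coord-surjective ℓ factor usesAll , factor
  where
  color : Fin n → Fin k
  color a = along ℓ c a y₀ z₀

  factor : ∀ x y z → c x y z ≡ color (coord ℓ x y z)
  factor = along-first⇒coord ℓ c (rainbow⇒constant n≥3 (messyFree c noPath ℓ) rainbow)
... | no noRainbow = ⊥-elim (atMostTwoColors n≥3 conf (λ ℓ r → noRainbow (ℓ , r))
                                (usesAll⇒atLeastThree k≥3 usesAll))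
  where
  conf : AllConfined c
  conf ℓ = confined (messyFree c noPath ℓ) (λ r → noRainbow (ℓ , r))
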